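{- Let $d\ge 2$ be an integer. If $d$ is TE-prime partitionable, then $d$ is HS-prime partitionable (both notions as defined in the context below).
   Context: An integer $n$ is called HS-prime partitionable if there is a partition $\{\mathbb{P}_1,\mathbb{P}_2\}$ of the set of all primes less than $n$ into two nonempty disjoint sets such that for all positive integers $n_1,n_2$ with $n_1+n_2=n$ there is some pair $(p_1,p_2)\in\mathbb{P}_1\times\mathbb{P}_2$ with $\gcd(n_1,p_1)>1$ or $\gcd(n_2,p_2)>1$. An integer $d$ is called TE-prime partitionable if there exist positive integers $n_1,n_2$ with $d=\gcd(n_1,n_2)$ such that for every pair of positive integers $d_1,d_2$ with $d_1+d_2=d$, either $\gcd(n_1,d_1)\neq 1$ or $\gcd(n_2,d_2)\neq 1$. -}

module Defs where

open import Data.Nat using (ℕ; _+_; _<_; _≤_)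
open import Data.Nat.GCD using (gcd)
open import Data.Nat.Primality using (Prime)
open import Data.Bool using (Bool; true; false)
open import Data.Product using (Σ; _×_; ∃-syntax)
open import Data.Sum using (_⊎_)
open import Relation.Binary.PropositionalEquality using (_≡_; _≢_)

PrimeBelow : ℕ → ℕ → Set
PrimeBelow n p = Prime p × p < n

-- A partition {P₁,P₂} of the primes below n into two (disjoint) parts is
-- encoded by a colouring c : ℕ → Bool:  P₁ = {p prime < n | c p ≡ true},
-- P₂ = {p prime < n | c p ≡ false}.  Disjointness and covering are automatic.
InP₁ : ℕ → (ℕ → Bool) → ℕ → Set
InP₁ n c p = PrimeBelow n p × c p ≡ true

InP₂ : ℕ → (ℕ → Bool) → ℕ → Set
InP₂ n c p = PrimeBelow n p × c p ≡ false

HS-prime-partitionable : ℕ → Set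
HS-prime-partitionable n =
  Σ (ℕ → Bool) λ c →
    (∃[ p ] InP₁ n c p) ×
    (∃[ p ] InP₂ n c p) ×
    ((n₁ n₂ : ℕ) → 1 ≤ n₁ → 1 ≤ n₂ → n₁ + n₂ ≡ n →
       ∃[ p₁ ] ∃[ p₂ ] (InP₁ n c p₁ × InP₂ n c p₂ ×
         (1 < gcd n₁ p₁ ⊎ 1 < gcd n₂ p₂)))

TE-prime-partitionable : ℕ → Set
TE-prime-partitionable d =
  ∃[ n₁ ] ∃[ n₂ ] (1 ≤ n₁ × 1 ≤ n₂ × d ≡ gcd n₁ n₂ ×
    ((d₁ d₂ : ℕ) → 1 ≤ d₁ → 1 ≤ d₂ → d₁ + d₂ ≡ d →
       gcd n₁ d₁ ≢ 1 ⊎ gcd n₂ d₂ ≢ 1))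

module Submission where

-- If d = gcd n₁ n₂ witnesses TE-prime-partitionability, colour the primes
-- below d by whether they divide n₁:  P₁ = {p | p ∣ n₁},  P₂ = {p | p ∤ n₁}.
--
-- The heart of the argument is `blocking-prime`: for every split d = d₁ + d₂
-- the TE-condition yields a prime p with  p ∣ n₁ ∧ p ∣ d₁  or  p ∤ n₁ ∧ p ∣ d₂.
-- (The TE-condition gives a prime dividing n₁ and d₁, or one dividing n₂ and d₂;
-- in the latter case, if it also divides n₁ it divides gcd n₁ n₂ = d and hence
-- d₁ = d - d₂.)  Such a prime lies below d, so it is in P₁ (resp. P₂) and makes
-- gcd d₁ p > 1 (resp. gcd d₂ p > 1).
--
-- Both parts are nonempty: for the split d = (d - 1) + 1 the blocking prime
-- cannot divide 1, so it lies in P₁; symmetrically the split 1 + (d - 1)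
-- gives an element of P₂.  For an arbitrary split, the blocking prime is then
-- paired with an element of the opposite part.

open import Defs
open import Data.Nat using (ℕ; _≤_)
open import Data.Nat.Base using (suc; _+_; _<_; NonZero; >-nonZero; ≢-nonZero; ≢-nonZero⁻¹; nonTrivial⇒n>1; s≤s)
open import Data.Nat.Properties using (+-comm; m<m+n; ≤-<-trans; <-≤-trans; ≤-refl)
open import Data.Nat.Divisibility using (_∣_; _∣?_; ∣-refl; ∣-trans; ∣⇒≤; ∣1⇒≡1; ∣m+n∣m⇒∣n; m∣m*n)
open import Data.Nat.GCD using (gcd; gcd-greatest; gcd[m,n]∣m; gcd[m,n]∣n; gcd[m,n]≢0)
open import Data.Nat.Primality using (Prime; ¬prime[1]; prime⇒nonZero; prime⇒nonTrivial)
open import Data.Nat.Primality.Factorisation using (factorise)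
open import Data.Nat.ListAction using (product)
open import Data.List.Base using ([]; _∷_)
open import Data.List.Relation.Unary.All using (_∷_)
open import Data.Bool using (Bool)
open import Data.Product using (_×_; _,_; ∃-syntax)
open import Data.Sum using (_⊎_; inj₁; inj₂)
open import Relation.Nullary using (¬_; yes; no; does; contradiction)
open import Relation.Nullary.Decidable using (dec-true; dec-false)
open import Relation.Binary.PropositionalEquality using (_≡_; _≢_; refl; sym; trans; subst)

prime-divisor : ∀ n → .{{NonZero n}} → n ≢ 1 → ∃[ p ] (Prime p × p ∣ n)
prime-divisor n n≢1 with factorise n
... | record { factors = [] ; isFactorisation = n≡1 } = contradiction n≡1 n≢1
... | record { factors = p ∷ ps ; isFactorisation = eq ; factorsPrime = p-prime ∷ _ } =
  p , p-prime , subst (p ∣_) (sym eq) (m∣m*n (product ps))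

gcd-nonZeroʳ : ∀ a b → .{{NonZero b}} → NonZero (gcd a b)
gcd-nonZeroʳ a b = ≢-nonZero (gcd[m,n]≢0 a b (inj₂ (≢-nonZero⁻¹ b)))

common-prime-divisor : ∀ a b → 1 ≤ b → gcd a b ≢ 1 → ∃[ p ] (Prime p × p ∣ a × p ∣ b)
common-prime-divisor a b 1≤b g≢1
  with p , p-prime , p∣g ← prime-divisor (gcd a b) ⦃ gcd-nonZeroʳ a b ⦃ >-nonZero 1≤b ⦄ ⦄ g≢1 =
  p , p-prime , ∣-trans p∣g (gcd[m,n]∣m a b) , ∣-trans p∣g (gcd[m,n]∣n a b)

prime-divisor⇒gcd>1 : ∀ {m p} → Prime p → p ∣ m → 1 < gcd m p
prime-divisor⇒gcd>1 {m} {p} p-prime p∣m =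
  <-≤-trans (nonTrivial⇒n>1 p ⦃ prime⇒nonTrivial p-prime ⦄)
            (∣⇒≤ ⦃ gcd-nonZeroʳ m p ⦃ prime⇒nonZero p-prime ⦄ ⦄ (gcd-greatest p∣m ∣-refl))

prime∤1 : ∀ {p} → Prime p → ¬ p ∣ 1
prime∤1 p-prime p∣1 = ¬prime[1] (subst Prime (∣1⇒≡1 p∣1) p-prime)

divisor<sum : ∀ {p m n} → 1 ≤ m → 1 ≤ n → p ∣ m → p < m + n
divisor<sum {m = m} 1≤m 1≤n p∣m = ≤-<-trans (∣⇒≤ ⦃ >-nonZero 1≤m ⦄ p∣m) (m<m+n m 1≤n)

∣-other-summand : ∀ {p m n s} → m + n ≡ s → p ∣ s → p ∣ n → p ∣ m
∣-other-summand {m = m} {n} m+n≡s p∣s p∣n =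
  ∣m+n∣m⇒∣n (subst (_ ∣_) (trans (sym m+n≡s) (+-comm m n)) p∣s) p∣n

TE-condition : ℕ → ℕ → ℕ → Set
TE-condition n₁ n₂ d =
  (d₁ d₂ : ℕ) → 1 ≤ d₁ → 1 ≤ d₂ → d₁ + d₂ ≡ d → gcd n₁ d₁ ≢ 1 ⊎ gcd n₂ d₂ ≢ 1

module DivisibilityColouring {n₁ n₂ d : ℕ} (d≡gcd : d ≡ gcd n₁ n₂) (te : TE-condition n₁ n₂ d) where

  colour : ℕ → Bool
  colour p = does (p ∣? n₁)

  below-d : ∀ {p d₁ d₂} → Prime p → 1 ≤ d₁ → 1 ≤ d₂ → d₁ + d₂ ≡ d →
            p ∣ d₁ ⊎ p ∣ d₂ → PrimeBelow d p
  below-d p-prime 1≤d₁ 1≤d₂ eq (inj₁ p∣d₁) =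
    p-prime , subst (_ <_) eq (divisor<sum 1≤d₁ 1≤d₂ p∣d₁)
  below-d {d₁ = d₁} {d₂} p-prime 1≤d₁ 1≤d₂ eq (inj₂ p∣d₂) =
    p-prime , subst (_ <_) (trans (+-comm d₂ d₁) eq) (divisor<sum 1≤d₂ 1≤d₁ p∣d₂)

  blocking-prime : ∀ d₁ d₂ → 1 ≤ d₁ → 1 ≤ d₂ → d₁ + d₂ ≡ d →
                   ∃[ p ] (Prime p × ((p ∣ n₁ × p ∣ d₁) ⊎ (¬ p ∣ n₁ × p ∣ d₂)))
  blocking-prime d₁ d₂ 1≤d₁ 1≤d₂ eq with te d₁ d₂ 1≤d₁ 1≤d₂ eq
  ... | inj₁ gcd≢1 with p , p-prime , p∣n₁ , p∣d₁ ← common-prime-divisor n₁ d₁ 1≤d₁ gcd≢1 =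
    p , p-prime , inj₁ (p∣n₁ , p∣d₁)
  ... | inj₂ gcd≢1 with q , q-prime , q∣n₂ , q∣d₂ ← common-prime-divisor n₂ d₂ 1≤d₂ gcd≢1
                   with q ∣? n₁
  ...   | no q∤n₁ = q , q-prime , inj₂ (q∤n₁ , q∣d₂)
  ...   | yes q∣n₁ = q , q-prime , inj₁ (q∣n₁ , ∣-other-summand eq q∣d q∣d₂)
    where
    q∣d : q ∣ d
    q∣d = subst (q ∣_) (sym d≡gcd) (gcd-greatest q∣n₁ q∣n₂)

  P₁-nonempty : ∀ m → 1 ≤ m → m + 1 ≡ d → ∃[ p ] InP₁ d colour p
  P₁-nonempty m 1≤m eq with blocking-prime m 1 1≤m ≤-refl eq
  ... | p , p-prime , inj₁ (p∣n₁ , p∣m) =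
    p , below-d p-prime 1≤m ≤-refl eq (inj₁ p∣m) , dec-true (p ∣? n₁) p∣n₁
  ... | p , p-prime , inj₂ (_ , p∣1) = contradiction p∣1 (prime∤1 p-prime)

  P₂-nonempty : ∀ m → 1 ≤ m → 1 + m ≡ d → ∃[ p ] InP₂ d colour p
  P₂-nonempty m 1≤m eq with blocking-prime 1 m ≤-refl 1≤m eq
  ... | p , p-prime , inj₁ (_ , p∣1) = contradiction p∣1 (prime∤1 p-prime)
  ... | p , p-prime , inj₂ (p∤n₁ , p∣m) =
    p , below-d p-prime ≤-refl 1≤m eq (inj₂ p∣m) , dec-false (p ∣? n₁) p∤n₁

  separates : ∃[ p ] InP₁ d colour p → ∃[ p ] InP₂ d colour p →
              (d₁ d₂ : ℕ) → 1 ≤ d₁ → 1 ≤ d₂ → d₁ + d₂ ≡ d →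
              ∃[ p₁ ] ∃[ p₂ ] (InP₁ d colour p₁ × InP₂ d colour p₂ ×
                (1 < gcd d₁ p₁ ⊎ 1 < gcd d₂ p₂))
  separates (p₁ , p₁∈P₁) (p₂ , p₂∈P₂) d₁ d₂ 1≤d₁ 1≤d₂ eq
    with blocking-prime d₁ d₂ 1≤d₁ 1≤d₂ eq
  ... | p , p-prime , inj₁ (p∣n₁ , p∣d₁) =
    p , p₂ , (below-d p-prime 1≤d₁ 1≤d₂ eq (inj₁ p∣d₁) , dec-true (p ∣? n₁) p∣n₁) , p₂∈P₂ ,
    inj₁ (prime-divisor⇒gcd>1 p-prime p∣d₁)
  ... | p , p-prime , inj₂ (p∤n₁ , p∣d₂) =
    p₁ , p , p₁∈P₁ , (below-d p-prime 1≤d₁ 1≤d₂ eq (inj₂ p∣d₂) , dec-false (p ∣? n₁) p∤n₁) ,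
    inj₂ (prime-divisor⇒gcd>1 p-prime p∣d₂)

lemma2 : (d : ℕ) → 2 ≤ d → TE-prime-partitionable d → HS-prime-partitionable d
lemma2 d@(suc m) (s≤s 1≤m) (n₁ , n₂ , _ , _ , d≡gcd , te) =
  colour , P₁∋p , P₂∋q , separates P₁∋p P₂∋q
  where
  open DivisibilityColouring {n₁} {n₂} d≡gcd te
  P₁∋p : ∃[ p ] InP₁ d colour p
  P₁∋p = P₁-nonempty m 1≤m (+-comm m 1)
  P₂∋q : ∃[ q ] InP₂ d colour q
  P₂∋q = P₂-nonempty m 1≤m refl
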